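{- Fix the following input: - a DNA sequence with positions $1,\dots,n$, where $n=3m$ codes for a protein of length $m$; - mutation sites $p_1,\dots,p_b\in\{1,\dots,m\}$, each with a positive integer $d_i$ (the number of decodons used at site $p_i$); - integers $0<o_{\min}\le o_{\max}<l_{\min}\le l_{\max}$. For $0\le s<e\le n$ let $\mathrm{cost}(s,e)=(e-s)\cdot\prod_{i\in I(s,e)} d_i$. Here $I(s,e)$ is the set of indices $i$ such that $\{3p_i-2,3p_i-1,3p_i\}\cap\{s+1,\dots,e\}\neq\emptyset$, and an empty product is $1$. Define $c[0],c[1],\dots,c[n]$ in increasing order of index. Set $c[0]=0$. For $1\le e\le n$, let $c[e]$ be the minimum of the following candidates, and $\infty$ if there are none: - $\mathrm{cost}(0,e)$, if $l_{\min}\le e\le l_{\max}$; - $c[e-j+k]+\mathrm{cost}(e-j,e)$, for all $j\in[l_{\min},l_{\max}]$ and $k\in[o_{\min},o_{\max}]$ with $e-j\ge 1$ and $c[e-j+k]\ne\infty$. This is the OligoBreak dynamic program. Then $c[n]$ equals the minimum total synthesis cost over all valid oligo designs for the whole sequence (and $c[n]=\infty$ if no valid design exists). That is, OligoBreak produces oligos that assemble into DNA sequences of length $n$ coding for the targeted protein variant library while minimizing the total number of synthesized nucleotides.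
   Context: A targeted protein variant library is specified by a protein of length $m$ (coded by DNA of length $n=3m$), mutation sites $p_1,\dots,p_b$, and at each site an amino acid set. That set is coded exactly (with no extra amino acids or STOP codons) by a minimum-size set of $d_i$ degenerate codons. The DNA is assembled from overlapping oligo sets. An oligo set is an interval of positions $\{s+1,\dots,e\}$, $0\le s<e\le n$. For it, one synthesizes one oligo of length $e-s$ for every combination of choices of one decodon at each mutation site whose codon positions $\{3p_i-2,3p_i-1,3p_i\}$ meet the interval. The oligo set therefore requires $\mathrm{cost}(s,e)$ synthesized nucleotides, with $\mathrm{cost}$ as defined in the claim. A valid oligo design is a sequence of intervals $\{s_t+1,\dots,e_t\}$, $t=1,\dots,k$, such that: - $s_1=0$ and $e_k=n$; - $l_{\min}\le e_t-s_t\le l_{\max}$ for all $t$; - for $1\le t<k$ the overlap length $e_t-s_{t+1}$ lies in $[o_{\min},o_{\max}]$. Its total synthesis cost is $\sum_{t=1}^k \mathrm{cost}(s_t,e_t)$. -}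

module Defs where

open import Data.Nat using (ℕ; zero; suc; _+_; _*_; _∸_; _≤_; _<_; _≤ᵇ_; _<ᵇ_)
open import Data.Bool using (Bool; true; false; if_then_else_; _∧_; _∨_)
open import Data.Maybe using (Maybe; just; nothing)
import Data.Maybe as Maybe
open import Data.List using (List; []; _∷_; _++_; map; applyUpTo; concatMap; head; last; foldr)
open import Data.Bool.ListAction using (any)
open import Data.Nat.ListAction using (sum)
open import Data.List.Relation.Unary.All using (All)
open import Data.List.Relation.Unary.Linked using (Linked)
open import Data.Product using (_×_; _,_; proj₁; proj₂)
open import Relation.Binary.PropositionalEquality using (_≡_)

-- ℕ∞ : natural numbers with ∞ (nothing = ∞)
ℕ∞ : Set
ℕ∞ = Maybe ℕ

min∞ : ℕ∞ → ℕ∞ → ℕ∞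
min∞ nothing y = y
min∞ (just x) nothing = just x
min∞ (just x) (just y) = just (if x ≤ᵇ y then x else y)

_+∞_ : ℕ∞ → ℕ → ℕ∞
nothing +∞ _ = nothing
just x +∞ y = just (x + y)

minimum∞ : List ℕ∞ → ℕ∞
minimum∞ = foldr min∞ nothing

-- the list a, a+1, ..., b  (empty if b < a)
between : ℕ → ℕ → List ℕ
between a b = applyUpTo (a +_) (suc b ∸ a)

-- A mutation site is a pair (p , d): position p in the protein, d decodons.
Site : Set
Site = ℕ × ℕ

meets : ℕ → ℕ → ℕ → Bool
meets s e p = any (λ x → (s <ᵇ x) ∧ (x ≤ᵇ e)) ((3 * p ∸ 2) ∷ (3 * p ∸ 1) ∷ (3 * p) ∷ [])

siteProduct : List Site → ℕ → ℕ → ℕ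
siteProduct [] s e = 1
siteProduct ((p , d) ∷ xs) s e =
  (if meets s e p then d else 1) * siteProduct xs s e

cost : List Site → ℕ → ℕ → ℕ
cost sites s e = (e ∸ s) * siteProduct sites s e

record Params : Set where
  constructor params
  field
    omin omax lmin lmax : ℕ
open Params public

-- One step of OligoBreak: compute c[e] (e ≥ 1) from the previously computed values
-- prev i = c[i] for i < e.
step : List Site → Params → ℕ → (ℕ → ℕ∞) → ℕ∞
step sites P e prev =
  minimum∞
    ( (if (lmin P ≤ᵇ e) ∧ (e ≤ᵇ lmax P) then just (cost sites 0 e) ∷ [] else [])
    ++ concatMap (λ j → concatMap (λ k →
           if 1 ≤ᵇ e ∸ j
             then (prev (e ∸ j + k) +∞ cost sites (e ∸ j) e) ∷ []
             else [])
         (between (omin P) (omax P)))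
       (between (lmin P) (lmax P)) )

-- table e i = c[i] for i ≤ e, computed in increasing order of index.
table : List Site → Params → ℕ → ℕ → ℕ∞
table sites P zero i = just 0
table sites P (suc e) i =
  if i ≤ᵇ e then table sites P e i else step sites P (suc e) (table sites P e)

oligoBreak : List Site → Params → ℕ → ℕ∞
oligoBreak sites P e = table sites P e e

-- Oligo sets are intervals {s+1,...,e}, represented by the pair (s , e).
Interval : Set
Interval = ℕ × ℕ

IntervalOK : Params → ℕ → Interval → Set
IntervalOK P n (s , e) = (s < e) × (e ≤ n) × (lmin P ≤ e ∸ s) × (e ∸ s ≤ lmax P)

OverlapOK : Params → Interval → Interval → Set
OverlapOK P (s , e) (s' , e') = (omin P + s' ≤ e) × (e ≤ omax P + s')

record ValidDesign (P : Params) (n : ℕ) (ds : List Interval) : Set where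
  field
    starts  : Maybe.map proj₁ (head ds) ≡ just 0
    ends    : Maybe.map proj₂ (last ds) ≡ just n
    lengths : All (IntervalOK P n) ds
    overlaps : Linked (OverlapOK P) ds

totalCost : List Site → List Interval → ℕ
totalCost sites ds = sum (map (λ { (s , e) → cost sites s e }) ds)

{-# OPTIONS --safe #-}
module Submission where

-- Call v achievable at e if some design of the prefix {1,…,e} costs v. The last oligo
-- {s+1,…,e} of such a design follows a design of a prefix {1,…,i} with i − s ∈ [omin, omax],
-- and omax < lmin forces s ≥ 1 and i < e; these are exactly the candidates of the dynamic
-- program, which only reads entries computed earlier. Hence every finite c[e] is achievable
-- (well-founded induction on e) and c[e] is at most every achievable cost (induction on the
-- design), while achievable costs at n are precisely the costs of valid designs.

open import Defs
open import Data.Nat using (ℕ; zero; suc; _+_; _*_; _∸_; _≤_; _<_; _≤ᵇ_; _<ᵇ_; z≤n; s≤s; s≤s⁻¹)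
open import Data.Nat.Properties
open import Data.Nat.Induction using (<-wellFounded)
open import Data.Bool using (true; false; T; if_then_else_; _∧_)
open import Data.Bool.Properties using (T-∧)
open import Data.Sum using (_⊎_; inj₁; inj₂)
open import Data.Product using (_×_; _,_; proj₁; proj₂; ∃-syntax; ∃₂)
import Data.Product as Product
open import Data.Maybe using (Maybe; just; nothing)
import Data.Maybe as Maybe
open import Data.Maybe.Relation.Unary.Any using (Any; just; drop-just)
open import Data.Maybe.Relation.Binary.Connected using (Connected; just)
open import Data.List using (List; []; _∷_; _++_; _∷ʳ_; head; last; concatMap)
open import Data.List.Reverse using (Reverse; []; _∶_∶ʳ_; reverseView)
open import Data.List.Relation.Unary.All using (All; []; _∷_)
import Data.List.Relation.Unary.All as All
open import Data.List.Relation.Unary.All.Properties using (∷ʳ⁺; ∷ʳ⁻)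
open import Data.List.Relation.Unary.Any using (here; there)
open import Data.List.Relation.Unary.Linked using (Linked; [-]; _∷_)
open import Data.List.Relation.Unary.Linked.Properties using (++⁺)
open import Data.List.Membership.Propositional using (_∈_; find; lose)
open import Data.List.Membership.Propositional.Properties
  using (∈-++⁺ˡ; ∈-++⁺ʳ; ∈-++⁻; ∈-concatMap⁺; ∈-concatMap⁻; ∈-applyUpTo⁺; ∈-applyUpTo⁻)
open import Function.Bundles using (Equivalence)
open import Induction.WellFounded using (Acc; acc)
open import Relation.Binary.PropositionalEquality using (_≡_; refl; sym; trans; cong; subst; subst₂)
open import Relation.Nullary using (¬_; contradiction)
open import Relation.Nullary.Reflects using (ofʸ; ofⁿ)

open ValidDesign

∈-if⁻ : ∀ {A : Set} b {xs : List A} {x} → x ∈ (if b then xs else []) → T b × x ∈ xs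
∈-if⁻ true p = _ , p

∈-if⁺ : ∀ {A : Set} {b} {xs : List A} {x} → T b → x ∈ xs → x ∈ (if b then xs else [])
∈-if⁺ {b = true} _ p = p

last-∷ʳ : ∀ {A : Set} (xs : List A) x → last (xs ∷ʳ x) ≡ just x
last-∷ʳ []           x = refl
last-∷ʳ (y ∷ [])     x = refl
last-∷ʳ (y ∷ z ∷ zs) x = last-∷ʳ (z ∷ zs) x

head-∷ʳ-++ : ∀ {A : Set} (xs : List A) y ys → head ((xs ∷ʳ y) ++ ys) ≡ head (xs ∷ʳ y)
head-∷ʳ-++ []      y ys = refl
head-∷ʳ-++ (_ ∷ _) y ys = refl

linked-∷ʳ⁻ : ∀ {A : Set} {R : A → A → Set} xs {y x} →
  Linked R ((xs ∷ʳ y) ∷ʳ x) → Linked R (xs ∷ʳ y) × R y x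
linked-∷ʳ⁻ []           (r ∷ [-]) = [-] , r
linked-∷ʳ⁻ (_ ∷ [])     (r ∷ rs)  = Product.map₁ (r ∷_) (linked-∷ʳ⁻ [] rs)
linked-∷ʳ⁻ (_ ∷ z ∷ zs) (r ∷ rs)  = Product.map₁ (r ∷_) (linked-∷ʳ⁻ (z ∷ zs) rs)

m<n∸o⇒o+m<n : ∀ o {m n} → m < n ∸ o → o + m < n
m<n∸o⇒o+m<n zero                m<n   = m<n
m<n∸o⇒o+m<n (suc o) {n = suc n} m<n∸o = s≤s (m<n∸o⇒o+m<n o m<n∸o)

∈-between⁻ : ∀ {a b x} → x ∈ between a b → a ≤ x × x ≤ b
∈-between⁻ {a} p with i , i< , refl ← ∈-applyUpTo⁻ (a +_) p =
  m≤m+n a i , s≤s⁻¹ (m<n∸o⇒o+m<n a i<)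

∈-between⁺ : ∀ {a b x} → a ≤ x → x ≤ b → x ∈ between a b
∈-between⁺ {a} {b} a≤x x≤b =
  subst (_∈ between a b) (m+[n∸m]≡n a≤x) (∈-applyUpTo⁺ (a +_) (∸-monoˡ-< (s≤s x≤b) a≤x))

min∞-selective : ∀ a b → min∞ a b ≡ a ⊎ min∞ a b ≡ b
min∞-selective nothing  b        = inj₂ refl
min∞-selective (just x) nothing  = inj₁ refl
min∞-selective (just x) (just y) with x ≤ᵇ y
... | true  = inj₁ refl
... | false = inj₂ refl

if-≤ᵇ-≤ : ∀ x y → (if x ≤ᵇ y then x else y) ≤ x × (if x ≤ᵇ y then x else y) ≤ y
if-≤ᵇ-≤ x y with x ≤ᵇ y | ≤ᵇ-reflects-≤ x y
... | true  | ofʸ x≤y = ≤-refl , x≤y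
... | false | ofⁿ x≰y = <⇒≤ (≰⇒> x≰y) , ≤-refl

min∞-≤ˡ : ∀ a b {c} → Any (_≤ c) a → Any (_≤ c) (min∞ a b)
min∞-≤ˡ (just x) nothing  x≤c        = x≤c
min∞-≤ˡ (just x) (just y) (just x≤c) = just (≤-trans (proj₁ (if-≤ᵇ-≤ x y)) x≤c)

min∞-≤ʳ : ∀ a b {c} → Any (_≤ c) b → Any (_≤ c) (min∞ a b)
min∞-≤ʳ nothing  b        y≤c        = y≤c
min∞-≤ʳ (just x) (just y) (just y≤c) = just (≤-trans (proj₂ (if-≤ᵇ-≤ x y)) y≤c)

minimum∞-∈ : ∀ xs {v} → minimum∞ xs ≡ just v → just v ∈ xs
minimum∞-∈ (x ∷ xs) eq with min∞-selective x (minimum∞ xs)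
... | inj₁ eqˡ = here (trans (sym eq) eqˡ)
... | inj₂ eqʳ = there (minimum∞-∈ xs (trans (sym eqʳ) eq))

minimum∞-≤ : ∀ {xs x c} → x ∈ xs → Any (_≤ c) x → Any (_≤ c) (minimum∞ xs)
minimum∞-≤ {x ∷ xs} (here refl) x≤c = min∞-≤ˡ x (minimum∞ xs) x≤c
minimum∞-≤ {y ∷ xs} (there x∈)  x≤c = min∞-≤ʳ y (minimum∞ xs) (minimum∞-≤ x∈ x≤c)

+∞-≤ : ∀ {a c} y → Any (_≤ c) a → Any (_≤ c + y) (a +∞ y)
+∞-≤ y (just a≤c) = just (+-monoˡ-≤ y a≤c)

just≡+∞⁻ : ∀ a y {v} → just v ≡ a +∞ y → ∃[ w ] a ≡ just w × v ≡ w + y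
just≡+∞⁻ (just w) y refl = w , refl , refl

totalCost-∷ʳ : ∀ sites ds s e → totalCost sites (ds ∷ʳ (s , e)) ≡ totalCost sites ds + cost sites s e
totalCost-∷ʳ sites []             s e = +-identityʳ _
totalCost-∷ʳ sites ((a , b) ∷ ds) s e =
  trans (cong (cost sites a b +_) (totalCost-∷ʳ sites ds s e)) (sym (+-assoc (cost sites a b) _ _))

IntervalOK-weaken : ∀ {P n n′} x → n ≤ n′ → IntervalOK P n x → IntervalOK P n′ x
IntervalOK-weaken _ n≤n′ (s<e , e≤n , l , u) = s<e , ≤-trans e≤n n≤n′ , l , u

connected-ending-at : ∀ {P} (m : Maybe Interval) {i s e} → Maybe.map proj₂ m ≡ just i →
  omin P + s ≤ i → i ≤ omax P + s → Connected (OverlapOK P) m (just (s , e))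
connected-ending-at (just (a , b)) refl o₁ o₂ = just (o₁ , o₂)

module OligoBreak (sites : List Site) (P : Params) (omax<lmin : omax P < lmin P) where

  lmin-pos : 1 ≤ lmin P
  lmin-pos = ≤-<-trans z≤n omax<lmin

  initial : ℕ → List ℕ∞
  initial e = if (lmin P ≤ᵇ e) ∧ (e ≤ᵇ lmax P) then just (cost sites 0 e) ∷ [] else []

  extension : ℕ → (ℕ → ℕ∞) → ℕ → ℕ → List ℕ∞
  extension e prev j k =
    if 1 ≤ᵇ e ∸ j then (prev (e ∸ j + k) +∞ cost sites (e ∸ j) e) ∷ [] else []

  extensions : ℕ → (ℕ → ℕ∞) → List ℕ∞
  extensions e prev =
    concatMap (λ j → concatMap (extension e prev j) (between (omin P) (omax P))) (between (lmin P) (lmax P))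

  oligoBreak-suc : ∀ e →
    oligoBreak sites P (suc e) ≡ minimum∞ (initial (suc e) ++ extensions (suc e) (table sites P e))
  oligoBreak-suc e with e <ᵇ e | <ᵇ-reflects-< e e
  ... | false | _       = refl
  ... | true  | ofʸ e<e = contradiction e<e (<-irrefl refl)

  table-stable : ∀ {e i} → i ≤ e → table sites P e i ≡ oligoBreak sites P i
  table-stable {zero}      z≤n    = refl
  table-stable {suc e} {i} i≤1+e with i ≤ᵇ e | ≤ᵇ-reflects-≤ i e
  ... | true  | ofʸ i≤e = table-stable i≤e
  ... | false | ofⁿ i≰e with refl ← ≤-antisym i≤1+e (≰⇒> i≰e) = sym (oligoBreak-suc e)

  -- The oligo {s+1,…,e} may be appended to a design of the prefix {1,…,i}.
  record Link (s i e : ℕ) : Set where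
    field
      start-pos   : 1 ≤ s
      length-min  : lmin P ≤ e ∸ s
      length-max  : e ∸ s ≤ lmax P
      overlap-min : omin P + s ≤ i
      overlap-max : i ≤ omax P + s

    start<end : s < e
    start<end = m∸n≢0⇒n<m (n>0⇒n≢0 (≤-trans lmin-pos length-min))

    prefix<end : i < e
    prefix<end = begin-strict
      i          ≤⟨ overlap-max ⟩
      omax P + s <⟨ +-monoˡ-< s omax<lmin ⟩
      lmin P + s ≤⟨ +-monoˡ-≤ s length-min ⟩
      e ∸ s + s  ≡⟨ m∸n+n≡m (<⇒≤ start<end) ⟩
      e          ∎
      where open ≤-Reasoning

    prefix-pos : 1 ≤ i
    prefix-pos = ≤-trans start-pos (≤-trans (m≤n+m s (omin P)) overlap-min)

  open Link

  offsets⇒link : ∀ {e j k} → lmin P ≤ j → j ≤ lmax P → omin P ≤ k → k ≤ omax P → 1 ≤ e ∸ j →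
    Link (e ∸ j) (e ∸ j + k) e
  offsets⇒link {e} {j} {k} j≥ j≤ k≥ k≤ s≥1 = record
    { start-pos   = s≥1
    ; length-min  = subst (lmin P ≤_) (sym e∸[e∸j]≡j) j≥
    ; length-max  = subst (_≤ lmax P) (sym e∸[e∸j]≡j) j≤
    ; overlap-min = subst (_≤ e ∸ j + k) (+-comm (e ∸ j) (omin P)) (+-monoʳ-≤ (e ∸ j) k≥)
    ; overlap-max = subst (e ∸ j + k ≤_) (+-comm (e ∸ j) (omax P)) (+-monoʳ-≤ (e ∸ j) k≤)
    }
    where
      e∸[e∸j]≡j : e ∸ (e ∸ j) ≡ j
      e∸[e∸j]≡j = m∸[m∸n]≡n (<⇒≤ (m∸n≢0⇒n<m (n>0⇒n≢0 s≥1)))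

  ∈-initial⁻ : ∀ {e x} → x ∈ initial e → lmin P ≤ e × e ≤ lmax P × x ≡ just (cost sites 0 e)
  ∈-initial⁻ {e} p with t , here refl ← ∈-if⁻ ((lmin P ≤ᵇ e) ∧ (e ≤ᵇ lmax P)) p =
    let l , u = Equivalence.to T-∧ t in ≤ᵇ⇒≤ _ _ l , ≤ᵇ⇒≤ _ _ u , refl

  ∈-initial⁺ : ∀ {e} → lmin P ≤ e → e ≤ lmax P → just (cost sites 0 e) ∈ initial e
  ∈-initial⁺ l u = ∈-if⁺ (Equivalence.from T-∧ (≤⇒≤ᵇ l , ≤⇒≤ᵇ u)) (here refl)

  ∈-extensions⁻ : ∀ {e prev x} → x ∈ extensions e prev →
    ∃₂ λ s i → Link s i e × x ≡ prev i +∞ cost sites s e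
  ∈-extensions⁻ {e} {prev} p
    with j , j∈ , p′ ← find (∈-concatMap⁻ (λ j → concatMap (extension e prev j) (between (omin P) (omax P))) p)
    with k , k∈ , p″ ← find (∈-concatMap⁻ (extension e prev j) p′)
    with s≥1 , here refl ← ∈-if⁻ (1 ≤ᵇ e ∸ j) p″ =
      let j≥ , j≤ = ∈-between⁻ j∈
          k≥ , k≤ = ∈-between⁻ k∈
      in e ∸ j , e ∸ j + k , offsets⇒link j≥ j≤ k≥ k≤ (≤ᵇ⇒≤ 1 _ s≥1) , refl

  ∈-extensions⁺ : ∀ {s i e prev} → Link s i e → prev i +∞ cost sites s e ∈ extensions e prev
  ∈-extensions⁺ {s} {i} {e} {prev} lk =
    subst₂ (λ s′ i′ → prev i′ +∞ cost sites s′ e ∈ extensions e prev) e∸[e∸s]≡s s+[i∸s]≡i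
      (∈-concatMap⁺ _ (lose (∈-between⁺ (length-min lk) (length-max lk))
        (∈-concatMap⁺ _ (lose (∈-between⁺ k≥ k≤)
          (∈-if⁺ (≤⇒≤ᵇ (subst (1 ≤_) (sym e∸[e∸s]≡s) (start-pos lk))) (here refl))))))
    where
      e∸[e∸s]≡s : e ∸ (e ∸ s) ≡ s
      e∸[e∸s]≡s = m∸[m∸n]≡n (<⇒≤ (start<end lk))
      s+[i∸s]≡i : e ∸ (e ∸ s) + (i ∸ s) ≡ i
      s+[i∸s]≡i = trans (cong (_+ (i ∸ s)) e∸[e∸s]≡s) (m+[n∸m]≡n (m+n≤o⇒n≤o (omin P) (overlap-min lk)))
      k≥ : omin P ≤ i ∸ s
      k≥ = m+n≤o⇒m≤o∸n (omin P) (overlap-min lk)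
      k≤ : i ∸ s ≤ omax P
      k≤ = m≤n+o⇒m∸n≤o i s (subst (i ≤_) (+-comm (omax P) s) (overlap-max lk))

  data Achievable : ℕ → ℕ → Set where
    first  : ∀ {e} → lmin P ≤ e → e ≤ lmax P → Achievable e (cost sites 0 e)
    extend : ∀ {s i e v} → Link s i e → Achievable i v → Achievable e (v + cost sites s e)

  achievable-pos : ∀ {e v} → Achievable e v → 1 ≤ e
  achievable-pos (first l _)   = ≤-trans lmin-pos l
  achievable-pos (extend lk _) = ≤-trans (start-pos lk) (<⇒≤ (start<end lk))

  oligoBreak-sound : ∀ {e v} → Acc _<_ e → 1 ≤ e → oligoBreak sites P e ≡ just v → Achievable e v
  oligoBreak-sound {suc e} (acc rec) _ eq
    with ∈-++⁻ (initial (suc e)) (minimum∞-∈ _ (trans (sym (oligoBreak-suc e)) eq))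
  ... | inj₁ p with l , u , refl ← ∈-initial⁻ p = first l u
  ... | inj₂ p
    with s , i , lk , eq′ ← ∈-extensions⁻ {prev = table sites P e} p
    with w , ow , refl ← just≡+∞⁻ _ _
           (trans eq′ (cong (_+∞ cost sites s (suc e)) (table-stable (s≤s⁻¹ (prefix<end lk)))))
    = extend lk (oligoBreak-sound (rec (prefix<end lk)) (prefix-pos lk) ow)

  oligoBreak-optimal : ∀ {e v} → Achievable e v → Any (_≤ v) (oligoBreak sites P e)
  oligoBreak-optimal {zero} a = contradiction (achievable-pos a) λ ()
  oligoBreak-optimal {suc e} (first l u) rewrite oligoBreak-suc e =
    minimum∞-≤ (∈-++⁺ˡ (∈-initial⁺ l u)) (just ≤-refl)
  oligoBreak-optimal {suc e} (extend {s} {i} lk a) rewrite oligoBreak-suc e =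
    minimum∞-≤ (∈-++⁺ʳ (initial (suc e)) (∈-extensions⁺ {prev = table sites P e} lk)) candidate≤
    where
      candidate≤ : Any (_≤ _) (table sites P e i +∞ cost sites s (suc e))
      candidate≤ rewrite table-stable (s≤s⁻¹ (prefix<end lk)) = +∞-≤ _ (oligoBreak-optimal a)

  achievable⇒design : ∀ {e v} → Achievable e v → ∃[ ds ] ValidDesign P e ds × totalCost sites ds ≡ v
  achievable⇒design {e} (first l u) = (0 , e) ∷ [] , design , +-identityʳ _
    where
      design : ValidDesign P e ((0 , e) ∷ [])
      design = record
        { starts = refl ; ends = refl
        ; lengths = (≤-trans lmin-pos l , ≤-refl , l , u) ∷ [] ; overlaps = [-] }
  achievable⇒design {e} (extend {s} lk a) with achievable⇒design a
  ... | [] , vd , _ = contradiction (starts vd) λ ()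
  ... | ds@(_ ∷ _) , vd , refl = ds ∷ʳ (s , e) , design , totalCost-∷ʳ sites ds s e
    where
      design : ValidDesign P e (ds ∷ʳ (s , e))
      design = record
        { starts   = starts vd
        ; ends     = cong (Maybe.map proj₂) (last-∷ʳ ds (s , e))
        ; lengths  = ∷ʳ⁺ (All.map (λ {x} → IntervalOK-weaken {P} x (<⇒≤ (prefix<end lk))) (lengths vd))
                         (start<end lk , ≤-refl , length-min lk , length-max lk)
        ; overlaps = ++⁺ (overlaps vd)
                       (connected-ending-at {P} (last ds) (ends vd) (overlap-min lk) (overlap-max lk)) [-]
        }

  consecutive⇒link : ∀ {B a i s e} → IntervalOK P B (a , i) → IntervalOK P B (s , e) →
    OverlapOK P (a , i) (s , e) → Link s i e
  consecutive⇒link {a = a} {i} {s} (_ , _ , lᵢ , _) (_ , _ , l , u) (o₁ , o₂) = record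
    { start-pos = positive-start s o₂ ; length-min = l ; length-max = u
    ; overlap-min = o₁ ; overlap-max = o₂ }
    where
      -- At s = 0 the previous oligo would lie inside {1,…,omax}, shorter than lmin.
      positive-start : ∀ s → i ≤ omax P + s → 1 ≤ s
      positive-start (suc _) _   = s≤s z≤n
      positive-start zero    i≤ = contradiction omax<lmin (≤⇒≯ (begin
        lmin P     ≤⟨ lᵢ ⟩
        i ∸ a      ≤⟨ m∸n≤m i a ⟩
        i          ≤⟨ i≤ ⟩
        omax P + 0 ≡⟨ +-identityʳ (omax P) ⟩
        omax P     ∎))
        where open ≤-Reasoning

  prefix⇒achievable : ∀ {B xs s e} → Reverse xs →
    Maybe.map proj₁ (head (xs ∷ʳ (s , e))) ≡ just 0 →
    All (IntervalOK P B) (xs ∷ʳ (s , e)) → Linked (OverlapOK P) (xs ∷ʳ (s , e)) →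
    Achievable e (totalCost sites (xs ∷ʳ (s , e)))
  prefix⇒achievable [] refl ((_ , _ , l , u) ∷ []) _ =
    subst (Achievable _) (sym (+-identityʳ _)) (first l u)
  prefix⇒achievable {s = s} {e} (xs ∶ rs ∶ʳ y) start oks links
    with oks′ , ok ← ∷ʳ⁻ oks | links′ , last-overlap ← linked-∷ʳ⁻ xs links =
    subst (Achievable e) (sym (totalCost-∷ʳ sites (xs ∷ʳ y) s e))
      (extend (consecutive⇒link (proj₂ (∷ʳ⁻ oks′)) ok last-overlap)
        (prefix⇒achievable rs (trans (cong (Maybe.map proj₁) (sym (head-∷ʳ-++ xs y _))) start) oks′ links′))

  design⇒achievable : ∀ {n ds} → ValidDesign P n ds → Achievable n (totalCost sites ds)
  design⇒achievable {ds = ds} vd with reverseView ds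
  ... | [] = contradiction (starts vd) λ ()
  ... | xs ∶ rs ∶ʳ (s , e)
    with refl ← trans (sym (cong (Maybe.map proj₂) (last-∷ʳ xs (s , e)))) (ends vd)
    = prefix⇒achievable rs (starts vd) (lengths vd) (overlaps vd)

theorem2 : (m : ℕ) → 1 ≤ m → (sites : List Site) →
    All (λ pd → (1 ≤ proj₁ pd) × (proj₁ pd ≤ m) × (1 ≤ proj₂ pd)) sites →
    (P : Params) →
    0 < omin P → omin P ≤ omax P → omax P < lmin P → lmin P ≤ lmax P →
    ((oligoBreak sites P (3 * m) ≡ nothing →
        (ds : List Interval) → ¬ ValidDesign P (3 * m) ds)
    × ((v : ℕ) → oligoBreak sites P (3 * m) ≡ just v →
        (∃[ ds ] (ValidDesign P (3 * m) ds × totalCost sites ds ≡ v))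
        × ((ds : List Interval) → ValidDesign P (3 * m) ds → v ≤ totalCost sites ds)))
-- Besides 1 ≤ m, only the hypothesis omax < lmin is used.
theorem2 m m≥1 sites _ P _ _ omax<lmin _ = no-design , optimal
  where
    open OligoBreak sites P omax<lmin
    lower-bound : ∀ {ds} → ValidDesign P (3 * m) ds → Any (_≤ totalCost sites ds) (oligoBreak sites P (3 * m))
    lower-bound vd = oligoBreak-optimal (design⇒achievable vd)
    no-design : oligoBreak sites P (3 * m) ≡ nothing → (ds : List Interval) → ¬ ValidDesign P (3 * m) ds
    no-design eq ds vd = contradiction (subst (Any _) eq (lower-bound vd)) λ ()
    optimal : (v : ℕ) → oligoBreak sites P (3 * m) ≡ just v →
      (∃[ ds ] (ValidDesign P (3 * m) ds × totalCost sites ds ≡ v))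
      × ((ds : List Interval) → ValidDesign P (3 * m) ds → v ≤ totalCost sites ds)
    optimal v eq =
      achievable⇒design (oligoBreak-sound (<-wellFounded _) (≤-trans (s≤s z≤n) (*-monoʳ-≤ 3 m≥1)) eq) ,
      λ ds vd → drop-just (subst (Any _) eq (lower-bound vd))
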